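{- There exists an instance of 2-SCSS-$(2,2)$ in which no optimum solution is general-reverse-compatible.
   Context: 2-SCSS-$(k_1,k_2)$: given a directed graph $G=(V,E)$ with weights $\omega:E\to\mathbb{R}_{\geq0}$, vertices $s,t$ and integers $k_1,k_2$, find directed $s\to t$ paths $F_1,\dots,F_{k_1}$ and directed $t\to s$ paths $B_1,\dots,B_{k_2}$ minimizing $\sum_{e\in E}\omega(e)\cdot\max\{|\{i:e\in F_i\}|,|\{j:e\in B_j\}|\}$. For an $s\to t$ path $F$ and a $t\to s$ path $B$, let $P_1,\dots,P_d$ be the maximal common sub-paths of $F$ and $B$, indexed in the order encountered while traversing $F$; $(F,B)$ is path-reverse-compatible if for each $j\in[d]$, $P_j$ is the $(d-j+1)$-th of these sub-paths encountered while traversing $B$. A solution $(\{F_1,\dots,F_{k_1}\},\{B_1,\dots,B_{k_2}\})$ is general-reverse-compatible if $(F_i,B_j)$ is path-reverse-compatible for all $i\in[k_1]$, $j\in[k_2]$. -}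

module Defs where

open import Data.Nat using (ℕ; zero; suc; _+_; _*_; _⊔_; _<_; _≤_)
open import Data.Bool using (Bool; true; false; T; _∧_; _∨_; if_then_else_)
open import Data.Fin using (Fin; _≟_)
open import Data.List using (List; []; _∷_; length; take; drop; last; map; allFin)
open import Data.Nat.ListAction using (sum)
open import Data.List.Relation.Unary.Unique.Propositional using (Unique)
open import Data.Maybe using (Maybe; just; nothing)
open import Data.Product using (Σ; _×_; ∃; ∃-syntax)
open import Data.Unit using (⊤)
open import Data.Empty using (⊥)
open import Relation.Nullary using (¬_)
open import Relation.Nullary.Decidable using (⌊_⌋)
open import Relation.Binary.PropositionalEquality using (_≡_)

-- An instance of 2-SCSS: a finite simple directed graph on vertex set Fin n,
-- given by its adjacency relation (adj u v = true iff (u,v) ∈ E),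
-- non-negative (natural-number) edge weights ω, and terminals s, t.
record Instance : Set where
  field
    n   : ℕ
    adj : Fin n → Fin n → Bool
    ω   : Fin n → Fin n → ℕ
    s   : Fin n
    t   : Fin n

module _ (G : Instance) where
  open Instance G

  V : Set
  V = Fin n

  Chain : List V → Set
  Chain []           = ⊤
  Chain (x ∷ [])     = ⊤
  Chain (x ∷ y ∷ xs) = T (adj x y) × Chain (y ∷ xs)

  IsPath : V → V → List V → Set
  IsPath u v []       = ⊥
  IsPath u v (x ∷ xs) = (x ≡ u) × (last (x ∷ xs) ≡ just v) × Unique (x ∷ xs) × Chain (x ∷ xs)

  uses : List V → V → V → Bool
  uses []           u v = false
  uses (x ∷ [])     u v = false
  uses (x ∷ y ∷ xs) u v = (⌊ x ≟ u ⌋ ∧ ⌊ y ≟ v ⌋) ∨ uses (y ∷ xs) u v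

  b2n : Bool → ℕ
  b2n true  = 1
  b2n false = 0

  load : {k : ℕ} → (Fin k → List V) → V → V → ℕ
  load {k} P u v = sum (map (λ i → b2n (uses (P i) u v)) (allFin k))

  record Solution (k₁ k₂ : ℕ) : Set where
    field
      F  : Fin k₁ → List V
      B  : Fin k₂ → List V
      F-path : (i : Fin k₁) → IsPath s t (F i)
      B-path : (j : Fin k₂) → IsPath t s (B j)

  cost : {k₁ k₂ : ℕ} → Solution k₁ k₂ → ℕ
  cost S = sum (map (λ u → sum (map (λ v →
             if adj u v then ω u v * (load (Solution.F S) u v ⊔ load (Solution.B S) u v) else 0)
             (allFin n))) (allFin n))

  Optimal : {k₁ k₂ : ℕ} → Solution k₁ k₂ → Set
  Optimal {k₁} {k₂} S = (S' : Solution k₁ k₂) → cost S ≤ cost S'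

  OccursAt : List V → List V → ℕ → Set
  OccursAt P xs i = take (length P) (drop i xs) ≡ P

  SubPath : List V → List V → Set
  SubPath P Q = ∃[ i ] OccursAt P Q i

  CommonSubPath : List V → List V → List V → Set
  CommonSubPath F Bk P = (2 ≤ length P) × SubPath P F × SubPath P Bk

  MaximalCommonSubPath : List V → List V → List V → Set
  MaximalCommonSubPath F Bk P =
    CommonSubPath F Bk P × ((Q : List V) → CommonSubPath F Bk Q → SubPath P Q → Q ≡ P)

  PathReverseCompatible : List V → List V → Set
  PathReverseCompatible F Bk =
    (P Q : List V) → MaximalCommonSubPath F Bk P → MaximalCommonSubPath F Bk Q →
    (i i' j j' : ℕ) → OccursAt P F i → OccursAt Q F i' → OccursAt P Bk j → OccursAt Q Bk j' →
    i < i' → j' < j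

  GeneralReverseCompatible : {k₁ k₂ : ℕ} → Solution k₁ k₂ → Set
  GeneralReverseCompatible {k₁} {k₂} S =
    (i : Fin k₁) (j : Fin k₂) → PathReverseCompatible (Solution.F S i) (Solution.B S j)

-- In the ten-vertex instance G below (s = 0, t = 1) every s → t path and every
-- t → s path is one of five, so optimality can be decided by exhausting the 5⁴
-- choices of two forward and two backward paths: some solution costs 14, and
-- every solution of cost at most 14 uses the forward path F* = 0 2 3 4 5 6 7 1 and the
-- backward path B* = 1 2 3 8 9 6 7 0.  Their maximal common sub-paths include
-- 2 → 3 and 6 → 7, which both paths traverse in the same order, so (F*, B*) is
-- not path-reverse-compatible.

module Submission where

open import Defs
open import Data.Bool using (Bool; true; false; if_then_else_)
open import Data.Fin using (Fin; zero; suc; _≟_)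
open import Data.Fin.Patterns using (0F; 1F; 2F; 3F; 4F; 5F; 6F; 7F; 8F; 9F)
open import Data.Fin.Properties using (injective⇒≤)
open import Data.List using (List; []; _∷_; [_]; length; take; drop; last; map; concatMap; filter; inits; _++_; lookup; allFin)
open import Data.List.Membership.Propositional using (_∈_)
open import Data.List.Membership.Propositional.Properties
  using (∈-map⁺; ∈-concat⁺′; ∈-filter⁺; ∈-allFin; ∈-lookup; ∈-++⁺ˡ; ∈-++⁺ʳ)
open import Data.List.Relation.Unary.All as All using (All; all?)
open import Data.List.Relation.Unary.Any using (here; there)
open import Data.List.Relation.Unary.Unique.Propositional using (Unique; _∷_)
open import Data.Maybe using (just)
open import Data.Nat using (ℕ; zero; suc; _⊔_; _*_; _≤_; _<_; _≤?_; s≤s; z≤n)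
open import Data.Nat.ListAction using (sum)
open import Data.Nat.Properties using (<⇒≤; <-asym)
open import Data.Product using (Σ; _×_; ∃-syntax; _,_; proj₁; proj₂)
open import Data.Sum using (_⊎_; inj₁; inj₂)
open import Data.Unit using (tt)
open import Data.Vec using (Vec; _∷_; [])
import Data.Vec as Vec
open import Function.Definitions using (Injective)
open import Relation.Binary.PropositionalEquality using (_≡_; refl; sym; cong; subst; subst₂)
open import Relation.Nullary using (¬_; Dec; yes; no; contradiction)
open import Relation.Nullary.Decidable using (from-yes; T?; _×-dec_; _⊎-dec_; _→-dec_)
import Data.List.Properties as List
import Data.Maybe.Properties as Maybe
import Data.List.Membership.DecPropositional as DecMembership
import Data.List.Relation.Unary.Unique.DecPropositional as DecUnique

lookup-injective : ∀ {a} {A : Set a} {xs : List A} → Unique xs → Injective _≡_ _≡_ (lookup xs)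
lookup-injective (_    ∷ _)   {zero}  {zero}  _  = refl
lookup-injective (x∉xs ∷ _)   {zero}  {suc j} eq = contradiction eq (All.lookup x∉xs (∈-lookup j))
lookup-injective (x∉xs ∷ _)   {suc i} {zero}  eq = contradiction (sym eq) (All.lookup x∉xs (∈-lookup i))
lookup-injective (_    ∷ uxs) {suc i} {suc j} eq = cong suc (lookup-injective uxs eq)

Unique⇒length≤ : ∀ {n} {xs : List (Fin n)} → Unique xs → length xs ≤ n
Unique⇒length≤ uxs = injective⇒≤ (lookup-injective uxs)

take-∈-inits : ∀ {a} {A : Set a} n (xs : List A) → take n xs ∈ inits xs
take-∈-inits zero    xs       = here refl
take-∈-inits (suc n) []       = here refl
take-∈-inits (suc n) (x ∷ xs) = there (∈-map⁺ (x ∷_) (take-∈-inits n xs))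

infixes : ∀ {a} {A : Set a} → List A → List (List A)
infixes []       = [ [] ]
infixes (x ∷ xs) = inits (x ∷ xs) ++ infixes xs

take-drop-∈-infixes : ∀ {a} {A : Set a} n i (xs : List A) → take n (drop i xs) ∈ infixes xs
take-drop-∈-infixes n zero    []       = here (List.take-[] n)
take-drop-∈-infixes n (suc i) []       = here (List.take-[] n)
take-drop-∈-infixes n zero    (x ∷ xs) = ∈-++⁺ˡ (take-∈-inits n (x ∷ xs))
take-drop-∈-infixes n (suc i) (x ∷ xs) = ∈-++⁺ʳ (inits (x ∷ xs)) (take-drop-∈-infixes n i xs)

module _ (G : Instance) where
  open Instance G

  SubPath⇒∈infixes : ∀ {P} xs → SubPath G P xs → P ∈ infixes xs
  SubPath⇒∈infixes {P} xs (i , occ) = subst (_∈ infixes xs) occ (take-drop-∈-infixes (length P) i xs)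

  successors : V G → List (V G)
  successors x = filter (λ y → T? (adj x y)) (allFin n)

  walks : ℕ → V G → List (List (V G))
  walks zero    x = [ [ x ] ]
  walks (suc k) x = [ x ] ∷ concatMap (λ y → map (x ∷_) (walks k y)) (successors x)

  Chain⇒∈walks : ∀ {k x} xs → Chain G (x ∷ xs) → length xs ≤ k → x ∷ xs ∈ walks k x
  Chain⇒∈walks {zero}  []       _            _         = here refl
  Chain⇒∈walks {suc k} []       _            _         = here refl
  Chain⇒∈walks {suc k} {x} (y ∷ ys) (xy , ch) (s≤s ys≤k) =
    there (∈-concat⁺′ (∈-map⁺ (x ∷_) (Chain⇒∈walks ys ch ys≤k))
                      (∈-map⁺ _ (∈-filter⁺ (λ y → T? (adj x y)) (∈-allFin y) xy)))

  chain? : (xs : List (V G)) → Dec (Chain G xs)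
  chain? []           = yes tt
  chain? (x ∷ [])     = yes tt
  chain? (x ∷ y ∷ xs) = T? (adj x y) ×-dec chain? (y ∷ xs)

  isPath? : ∀ u v (xs : List (V G)) → Dec (IsPath G u v xs)
  isPath? u v []       = no λ ()
  isPath? u v (x ∷ xs) =
    (x ≟ u) ×-dec Maybe.≡-dec _≟_ (last (x ∷ xs)) (just v) ×-dec
    DecUnique.unique? _≟_ (x ∷ xs) ×-dec chain? (x ∷ xs)

  paths : V G → V G → List (List (V G))
  paths u v = filter (isPath? u v) (walks n u)

  IsPath⇒∈paths : ∀ {u v} xs → IsPath G u v xs → xs ∈ paths u v
  IsPath⇒∈paths {u} {v} (x ∷ xs) p@(refl , _ , uxs , ch) =
    ∈-filter⁺ (isPath? u v) (Chain⇒∈walks xs ch (<⇒≤ (Unique⇒length≤ uxs))) p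

  open DecMembership (List.≡-dec (_≟_ {n = n})) using (_∈?_)

  MaximalAmongInfixes : List (V G) → List (V G) → List (V G) → Set
  MaximalAmongInfixes F B P =
    All (λ (Q : List (V G)) → 2 ≤ length Q → P ∈ infixes Q → Q ∈ infixes B → Q ≡ P) (infixes F)

  maximalAmongInfixes? : ∀ F B P → Dec (MaximalAmongInfixes F B P)
  maximalAmongInfixes? F B P = all? (λ (Q : List (V G)) →
    (2 ≤? length Q) →-dec ((P ∈? infixes Q) →-dec ((Q ∈? infixes B) →-dec List.≡-dec _≟_ Q P)))
    (infixes F)

  maximal-from-infixes : ∀ {F B P} → CommonSubPath G F B P → MaximalAmongInfixes F B P →
                         MaximalCommonSubPath G F B P
  maximal-from-infixes {F} {B} common max = common , λ Q (2≤∣Q∣ , Q⊑F , Q⊑B) P⊑Q →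
    All.lookup max (SubPath⇒∈infixes F Q⊑F) 2≤∣Q∣ (SubPath⇒∈infixes Q P⊑Q) (SubPath⇒∈infixes B Q⊑B)

  sameOrder⇒¬PathReverseCompatible :
    ∀ {F B P Q i i′ j j′} → MaximalCommonSubPath G F B P → MaximalCommonSubPath G F B Q →
    OccursAt G P F i → OccursAt G Q F i′ → OccursAt G P B j → OccursAt G Q B j′ →
    i < i′ → j < j′ → ¬ PathReverseCompatible G F B
  sameOrder⇒¬PathReverseCompatible {i = i} {i′} {j} {j′} maxP maxQ P∈F Q∈F P∈B Q∈B i<i′ j<j′ compatible =
    <-asym j<j′ (compatible _ _ maxP maxQ i i′ j j′ P∈F Q∈F P∈B Q∈B i<i′)

  -- `cost` with the solution replaced by its two path families, so that it can
  -- be evaluated on candidate paths without their path proofs.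
  familyCost : ∀ {k₁ k₂} → Vec (List (V G)) k₁ → Vec (List (V G)) k₂ → ℕ
  familyCost Fs Bs = sum (map (λ u → sum (map (λ v →
    if adj u v then ω u v * (load G (Vec.lookup Fs) u v ⊔ load G (Vec.lookup Bs) u v) else 0)
    (allFin n))) (allFin n))

  -- Holds by computation: `load` inspects a family only at its two indices.
  cost≡familyCost : (S : Solution G 2 2) → let open Solution S in
                    cost G S ≡ familyCost (F 0F ∷ F 1F ∷ []) (B 0F ∷ B 1F ∷ [])
  cost≡familyCost S = refl

adjacency : Fin 10 → Fin 10 → Bool
adjacency 0F 2F = true
adjacency 0F 8F = true
adjacency 1F 2F = true
adjacency 1F 4F = true
adjacency 2F 3F = true
adjacency 3F 4F = true
adjacency 3F 8F = true
adjacency 4F 5F = true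
adjacency 5F 0F = true
adjacency 5F 6F = true
adjacency 6F 7F = true
adjacency 7F 0F = true
adjacency 7F 1F = true
adjacency 8F 9F = true
adjacency 9F 1F = true
adjacency 9F 6F = true
adjacency _  _  = false

weight : Fin 10 → Fin 10 → ℕ
weight 4F 5F = 2
weight 8F 9F = 2
weight 3F 4F = 0
weight 3F 8F = 0
weight 5F 6F = 0
weight 9F 6F = 0
weight _  _  = 1

G : Instance
G = record { n = 10 ; adj = adjacency ; ω = weight ; s = 0F ; t = 1F }

F* B* : List (Fin 10)
F* = 0F ∷ 2F ∷ 3F ∷ 4F ∷ 5F ∷ 6F ∷ 7F ∷ 1F ∷ []
B* = 1F ∷ 2F ∷ 3F ∷ 8F ∷ 9F ∷ 6F ∷ 7F ∷ 0F ∷ []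

forward backward : List (List (Fin 10))
forward =
  F* ∷
  (0F ∷ 2F ∷ 3F ∷ 8F ∷ 9F ∷ 1F ∷ []) ∷
  (0F ∷ 2F ∷ 3F ∷ 8F ∷ 9F ∷ 6F ∷ 7F ∷ 1F ∷ []) ∷
  (0F ∷ 8F ∷ 9F ∷ 1F ∷ []) ∷
  (0F ∷ 8F ∷ 9F ∷ 6F ∷ 7F ∷ 1F ∷ []) ∷ []
backward =
  (1F ∷ 2F ∷ 3F ∷ 4F ∷ 5F ∷ 0F ∷ []) ∷
  (1F ∷ 2F ∷ 3F ∷ 4F ∷ 5F ∷ 6F ∷ 7F ∷ 0F ∷ []) ∷
  B* ∷
  (1F ∷ 4F ∷ 5F ∷ 0F ∷ []) ∷
  (1F ∷ 4F ∷ 5F ∷ 6F ∷ 7F ∷ 0F ∷ []) ∷ []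

forward-paths : paths G 0F 1F ≡ forward
forward-paths = refl

backward-paths : paths G 1F 0F ≡ backward
backward-paths = refl

S₀ : Solution G 2 2
S₀ = record
  { F      = Vec.lookup (F* ∷ F′ ∷ [])
  ; B      = Vec.lookup (B* ∷ B′ ∷ [])
  ; F-path = λ { 0F → from-yes (isPath? G 0F 1F F*) ; 1F → from-yes (isPath? G 0F 1F F′) }
  ; B-path = λ { 0F → from-yes (isPath? G 1F 0F B*) ; 1F → from-yes (isPath? G 1F 0F B′) }
  }
  where
  F′ B′ : List (Fin 10)
  F′ = 0F ∷ 8F ∷ 9F ∷ 1F ∷ []
  B′ = 1F ∷ 4F ∷ 5F ∷ 0F ∷ []

cost-S₀ : cost G S₀ ≡ 14
cost-S₀ = refl

F*-B*-not-compatible : ¬ PathReverseCompatible G F* B*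
F*-B*-not-compatible =
  sameOrder⇒¬PathReverseCompatible G {i = 1} {5} {1} {5} 2→3 6→7 refl refl refl refl 1<5 1<5
  where
  1<5 : 1 < 5
  1<5 = s≤s (s≤s z≤n)
  2→3 : MaximalCommonSubPath G F* B* (2F ∷ 3F ∷ [])
  2→3 = maximal-from-infixes G (s≤s (s≤s z≤n) , (1 , refl) , (1 , refl))
          (from-yes (maximalAmongInfixes? G F* B* (2F ∷ 3F ∷ [])))
  6→7 : MaximalCommonSubPath G F* B* (6F ∷ 7F ∷ [])
  6→7 = maximal-from-infixes G (s≤s (s≤s z≤n) , (5 , refl) , (5 , refl))
          (from-yes (maximalAmongInfixes? G F* B* (6F ∷ 7F ∷ [])))

Contains : Vec (List (Fin 10)) 2 → List (Fin 10) → Set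
Contains (p₀ ∷ p₁ ∷ []) p = p₀ ≡ p ⊎ p₁ ≡ p

contains? : ∀ ps p → Dec (Contains ps p)
contains? (p₀ ∷ p₁ ∷ []) p = List.≡-dec _≟_ p₀ p ⊎-dec List.≡-dec _≟_ p₁ p

Contains⇒∃ : ∀ (f : Fin 2 → List (Fin 10)) {p} → Contains (f 0F ∷ f 1F ∷ []) p → ∃[ i ] f i ≡ p
Contains⇒∃ f (inj₁ eq) = 0F , eq
Contains⇒∃ f (inj₂ eq) = 1F , eq

cost≤14⇒uses-F*-B* :
  All (λ f₀ → All (λ f₁ → All (λ b₀ → All (λ b₁ →
    familyCost G (f₀ ∷ f₁ ∷ []) (b₀ ∷ b₁ ∷ []) ≤ 14 →
    Contains (f₀ ∷ f₁ ∷ []) F* × Contains (b₀ ∷ b₁ ∷ []) B*)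
  backward) backward) forward) forward
cost≤14⇒uses-F*-B* = from-yes
  (all? (λ f₀ → all? (λ f₁ → all? (λ b₀ → all? (λ b₁ →
    (familyCost G (f₀ ∷ f₁ ∷ []) (b₀ ∷ b₁ ∷ []) ≤? 14) →-dec
    (contains? (f₀ ∷ f₁ ∷ []) F* ×-dec contains? (b₀ ∷ b₁ ∷ []) B*))
  backward) backward) forward) forward)

optimum-uses-F*-B* : (S : Solution G 2 2) → Optimal G S →
                     (∃[ i ] Solution.F S i ≡ F*) × (∃[ j ] Solution.B S j ≡ B*)
optimum-uses-F*-B* S optimal =
  Contains⇒∃ F (proj₁ uses-F*-B*) , Contains⇒∃ B (proj₂ uses-F*-B*)
  where
  open Solution S
  ∈forward : ∀ i → F i ∈ forward
  ∈forward i = subst (F i ∈_) forward-paths (IsPath⇒∈paths G (F i) (F-path i))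
  ∈backward : ∀ j → B j ∈ backward
  ∈backward j = subst (B j ∈_) backward-paths (IsPath⇒∈paths G (B j) (B-path j))
  cost≤14 : familyCost G (F 0F ∷ F 1F ∷ []) (B 0F ∷ B 1F ∷ []) ≤ 14
  cost≤14 = subst (_≤ 14) (cost≡familyCost G S) (subst (cost G S ≤_) cost-S₀ (optimal S₀))
  uses-F*-B* : Contains (F 0F ∷ F 1F ∷ []) F* × Contains (B 0F ∷ B 1F ∷ []) B*
  uses-F*-B* = All.lookup (All.lookup (All.lookup (All.lookup cost≤14⇒uses-F*-B*
    (∈forward 0F)) (∈forward 1F)) (∈backward 0F)) (∈backward 1F) cost≤14

theorem4 : Σ Instance (λ G → Solution G 2 2 × ((S : Solution G 2 2) → Optimal G S → ¬ GeneralReverseCompatible G S))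
theorem4 = G , S₀ , λ S optimal compatible →
  let (i , Fi≡F*) , (j , Bj≡B*) = optimum-uses-F*-B* S optimal
  in F*-B*-not-compatible (subst₂ (PathReverseCompatible G) Fi≡F* Bj≡B* (compatible i j))
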